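{- Let $d$ be a positive integer. If there exists a positive integer $k$ such that $$\frac{p_{k+1}^2-2}{h(k)+1} \ge d,$$ then for every integer $a$ with $\gcd(a,d)=1$, the set $a+d\mathbb{Z}=\{a+dn : n\in\mathbb{Z}\}$ contains at least one (positive) prime.
   Context: $p_j$ denotes the $j$th prime ($p_1=2,p_2=3,\dots$). The primorial is $p_k\# = \prod_{j=1}^k p_j$. For a positive integer $n$, the Jacobsthal function $g(n)$ is the smallest positive integer $m$ such that every sequence of $m$ consecutive integers contains at least one integer coprime to $n$. The primorial Jacobsthal function is $h(k)=g(p_k\#)$. "Prime" means positive prime. -}

module Defs where

open import Data.Nat using (ℕ; zero; suc; _+_; _*_; _≤_; _<_)
open import Data.Nat.Primality using (Prime; prime?)
open import Data.Nat.Coprimality using (Coprime)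
open import Data.Integer as ℤ using (ℤ; +_; ∣_∣)
open import Data.List using (List; length; filter; upTo)
open import Data.Nat.ListAction using (product)
open import Data.Product using (_×_; ∃-syntax)
open import Relation.Binary.PropositionalEquality using (_≡_)

primesBelow : ℕ → List ℕ
primesBelow n = filter prime? (upTo n)

primeCount : ℕ → ℕ
primeCount n = length (primesBelow n)

-- NthPrime j p  :  p = p_j  (1-indexed: p_1 = 2, p_2 = 3, ...)
NthPrime : ℕ → ℕ → Set
NthPrime j p = Prime p × suc (primeCount p) ≡ j

-- product of all primes ≤ p ; for p = p_k this is the primorial p_k#
primorialUpTo : ℕ → ℕ
primorialUpTo p = product (primesBelow (suc p))

CoversWindows : ℕ → ℕ → Set
CoversWindows n m = ∀ (x : ℤ) → ∃[ i ] (i < m × Coprime ∣ x ℤ.+ + i ∣ n)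

IsJacobsthal : ℕ → ℕ → Set
IsJacobsthal n m = 1 ≤ m × CoversWindows n m × (∀ m′ → 1 ≤ m′ → CoversWindows n m′ → m ≤ m′)

{-# OPTIONS --safe #-}
-- Write a = y + q d with 2 ≤ y ≤ d + 1, so that gcd(y, d) = 1, and let u be an inverse of d
-- modulo every prime e ≤ p_k not dividing d. Some i < h(k) makes u y + i coprime to p_k#.
-- Then z = y + d i ≡ a (mod d) has no prime factor e ≤ p_k: if e ∣ d then e ∣ y, and
-- otherwise u z ≡ u y + i (mod e). As 2 ≤ z ≤ d (h(k) + 1) < p_{k+1}², z is prime.
module Submission where

open import Defs
open import Data.Nat using (ℕ; zero; suc; _+_; _*_; _∸_; _^_; _≤_; _<_; _≤′_; ≤′-reflexive; ≤′-step; z≤n; s≤s; NonZero; >-nonZero⁻¹; n>1⇒nonTrivial)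
open import Data.Nat.Properties
open import Data.Nat.Divisibility using (_∣_; _∣?_; ∣-trans; ∣1⇒≡1; ∣m+n∣m⇒∣n; ∣m⇒∣m*n)
open import Data.Nat.Coprimality as Coprime using (Coprime; coprime-divisor; coprime-Bézout; gcd≡1⇒coprime)
open import Data.Nat.GCD using (module Bézout)
open import Data.Nat.Primality
open import Data.Nat.ListAction using (product)
open import Data.Nat.ListAction.Properties using (∈⇒∣product)
open import Data.Integer as ℤ using (ℤ; +_; ∣_∣; -_; _-_; 1ℤ)
open import Data.Integer.Properties using (pos-+; pos-*; neg-distribˡ-*; +-injective) renaming (+-assoc to ℤ-+-assoc)
open import Data.Integer.DivMod using (_%ℕ_; _/ℕ_; a≡a%ℕn+[a/ℕn]*n; n%ℕd<d)
open import Data.Integer.Divisibility.Signed as Signed using (divides; ∣ᵤ⇒∣; ∣⇒∣ᵤ)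
open import Data.Integer.GCD using (gcd)
open import Data.Integer.Tactic.RingSolver using (solve-∀)
open import Data.List using (List; []; _∷_; [_]; _++_; length; filter; upTo)
open import Data.List.Properties using (filter-++; length-++; upTo-∷ʳ; filter-accept)
open import Data.List.Relation.Unary.All as All using (All; []; _∷_)
open import Data.List.Membership.Propositional using (_∈_)
open import Data.List.Membership.Propositional.Properties using (∈-filter⁺; ∈-filter⁻; ∈-upTo⁺)
open import Data.Product using (_×_; ∃-syntax; _,_; proj₂)
open import Data.Sum using (inj₁; inj₂)
open import Data.Empty using (⊥-elim)
open import Relation.Nullary using (¬_; ¬?; yes; no)
open import Relation.Binary.PropositionalEquality using (_≡_; refl; sym; trans; cong; subst; module ≡-Reasoning)
open import Function using (_∘_)

primeCount-suc : ∀ n → primeCount (suc n) ≡ primeCount n + length (filter prime? [ n ])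
primeCount-suc n = begin
  length (filter prime? (upTo (suc n)))                  ≡⟨ cong (λ ns → length (filter prime? ns)) (upTo-∷ʳ n) ⟨
  length (filter prime? (upTo n ++ [ n ]))               ≡⟨ cong length (filter-++ prime? (upTo n) [ n ]) ⟩
  length (filter prime? (upTo n) ++ filter prime? [ n ]) ≡⟨ length-++ (filter prime? (upTo n)) ⟩
  primeCount n + length (filter prime? [ n ])            ∎
  where open ≡-Reasoning

primeCount-mono-≤ : ∀ {m n} → m ≤ n → primeCount m ≤ primeCount n
primeCount-mono-≤ = go ∘ ≤⇒≤′
  where
  go : ∀ {m n} → m ≤′ n → primeCount m ≤ primeCount n
  go (≤′-reflexive refl) = ≤-refl
  go (≤′-step {n} m≤′n) = ≤-trans (go m≤′n) (subst (primeCount n ≤_) (sym (primeCount-suc n)) (m≤m+n _ _))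

primeCount-suc-prime : ∀ {p} → Prime p → primeCount (suc p) ≡ suc (primeCount p)
primeCount-suc-prime {p} pp rewrite primeCount-suc p | filter-accept prime? {xs = []} pp = +-comm _ 1

prime<⇒primeCount< : ∀ {p q} → Prime p → p < q → primeCount p < primeCount q
prime<⇒primeCount< pp p<q = subst (_≤ _) (primeCount-suc-prime pp) (primeCount-mono-≤ p<q)

nthPrime-gap : ∀ {k p p′ e} → NthPrime k p → NthPrime (suc k) p′ → Prime e → e < p′ → e ≤ p
nthPrime-gap {p = p} {p′} {e} (pp , refl) (_ , count[p′]) pe e<p′ = ≮⇒≥ λ p<e →
  <-irrefl refl (begin-strict
    primeCount e  <⟨ prime<⇒primeCount< pe e<p′ ⟩
    primeCount p′ ≡⟨ suc-injective count[p′] ⟩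
    suc (primeCount p) ≤⟨ prime<⇒primeCount< pp p<e ⟩
    primeCount e  ∎)
  where open ≤-Reasoning

prime∣coprime⇒∤ : ∀ {e m n} → Prime e → Coprime m n → e ∣ m → ¬ e ∣ n
prime∣coprime⇒∤ pe c e∣m e∣n = ¬prime[1] (subst Prime (c (e∣m , e∣n)) pe)

prime∤⇒coprime : ∀ {p n} → Prime p → ¬ p ∣ n → Coprime p n
prime∤⇒coprime pp p∤n (i∣p , i∣n) with prime⇒irreducible pp i∣p
... | inj₁ i≡1 = i≡1
... | inj₂ refl = ⊥-elim (p∤n i∣n)

product-coprime : ∀ {n} ps → All (λ p → Coprime p n) ps → Coprime (product ps) n
product-coprime []       []         (i∣1 , _)   = ∣1⇒≡1 i∣1
product-coprime (p ∷ ps) (c ∷ cs) {i} (i∣p*ps , i∣n) =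
  product-coprime ps cs (coprime-divisor coprime[i,p] i∣p*ps , i∣n)
  where
  coprime[i,p] : Coprime i p
  coprime[i,p] (j∣i , j∣p) = c (j∣p , ∣-trans j∣i i∣n)

prime≤⇒∣primorialUpTo : ∀ {e p} → Prime e → e ≤ p → e ∣ primorialUpTo p
prime≤⇒∣primorialUpTo pe e≤p = ∈⇒∣product (∈-filter⁺ prime? (∈-upTo⁺ (s≤s e≤p)) pe)

pos-1+*≡* : ∀ a b c e → 1 + a * b ≡ c * e → 1ℤ ℤ.+ + a ℤ.* + b ≡ + c ℤ.* + e
pos-1+*≡* a b c e eq = begin
  1ℤ ℤ.+ + a ℤ.* + b ≡⟨ cong (ℤ._+_ 1ℤ) (pos-* a b) ⟨
  1ℤ ℤ.+ + (a * b)   ≡⟨ pos-+ 1 (a * b) ⟨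
  + (1 + a * b)      ≡⟨ cong +_ eq ⟩
  + (c * e)          ≡⟨ pos-* c e ⟩
  + c ℤ.* + e        ∎
  where open ≡-Reasoning

pos-+* : ∀ y d i → + (y + d * i) ≡ + y ℤ.+ + d ℤ.* + i
pos-+* y d i = trans (pos-+ y (d * i)) (cong (ℤ._+_ (+ y)) (pos-* d i))

coprime⇒inverseℤ : ∀ {d n} → Coprime d n → ∃[ u ] (+ n Signed.∣ u ℤ.* + d - 1ℤ)
coprime⇒inverseℤ {d} {n} c with coprime-Bézout c
... | Bézout.+- x y eq = + x , divides (+ y) (begin
  + x ℤ.* + d - 1ℤ              ≡⟨ cong (_- 1ℤ) (pos-1+*≡* y n x d eq) ⟨
  (1ℤ ℤ.+ + y ℤ.* + n) - 1ℤ     ≡⟨ 1+m-1≡m (+ y ℤ.* + n) ⟩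
  + y ℤ.* + n                   ∎)
  where
  open ≡-Reasoning
  1+m-1≡m : ∀ m → (1ℤ ℤ.+ m) - 1ℤ ≡ m
  1+m-1≡m = solve-∀
... | Bézout.-+ x y eq = - + x , divides (- + y) (begin
  (- + x) ℤ.* + d - 1ℤ          ≡⟨ -m*n-1≡-[1+m*n] (+ x) (+ d) ⟩
  - (1ℤ ℤ.+ + x ℤ.* + d)        ≡⟨ cong -_ (pos-1+*≡* x d y n eq) ⟩
  - (+ y ℤ.* + n)               ≡⟨ neg-distribˡ-* (+ y) (+ n) ⟩
  (- + y) ℤ.* + n               ∎)
  where
  open ≡-Reasoning
  -m*n-1≡-[1+m*n] : ∀ m n → (- m) ℤ.* n - 1ℤ ≡ - (1ℤ ℤ.+ m ℤ.* n)
  -m*n-1≡-[1+m*n] = solve-∀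

primesUpToNotDividing : ℕ → ℕ → List ℕ
primesUpToNotDividing p d = filter (λ e → ¬? (e ∣? d)) (primesBelow (suc p))

∈primesUpToNotDividing⁺ : ∀ {e p d} → Prime e → e ≤ p → ¬ e ∣ d → e ∈ primesUpToNotDividing p d
∈primesUpToNotDividing⁺ {d = d} pe e≤p e∤d = ∈-filter⁺ (λ e → ¬? (e ∣? d)) (∈-filter⁺ prime? (∈-upTo⁺ (s≤s e≤p)) pe) e∤d

∈primesUpToNotDividing⁻ : ∀ {e} p d → e ∈ primesUpToNotDividing p d → Prime e × ¬ e ∣ d
∈primesUpToNotDividing⁻ p d e∈qs with ∈-filter⁻ (λ e → ¬? (e ∣? d)) {xs = primesBelow (suc p)} e∈qs
... | e∈ps , e∤d = proj₂ (∈-filter⁻ prime? {xs = upTo (suc p)} e∈ps) , e∤d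

primesUpToNotDividing-coprime : ∀ p d → Coprime (product (primesUpToNotDividing p d)) d
primesUpToNotDividing-coprime p d = product-coprime _ (All.tabulate coprime-member)
  where
  coprime-member : ∀ {e} → e ∈ primesUpToNotDividing p d → Coprime e d
  coprime-member e∈qs = let pe , e∤d = ∈primesUpToNotDividing⁻ p d e∈qs in prime∤⇒coprime pe e∤d

inverse-mod-primes≤ : ∀ d p → ∃[ u ] (∀ {e} → Prime e → e ≤ p → ¬ e ∣ d → + e Signed.∣ u ℤ.* + d - 1ℤ)
inverse-mod-primes≤ d p with coprime⇒inverseℤ (Coprime.sym (primesUpToNotDividing-coprime p d))
... | u , Q∣ud-1 = u , λ {e} pe e≤p e∤d →
  Signed.∣-trans (∣ᵤ⇒∣ {+ e} (∈⇒∣product (∈primesUpToNotDividing⁺ pe e≤p e∤d))) Q∣ud-1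

window-avoiding-small-primes : ∀ {p m y d} → CoversWindows (primorialUpTo p) m → Coprime y d →
                               ∃[ i ] (i < m × ∀ {e} → Prime e → e ≤ p → ¬ e ∣ y + d * i)
window-avoiding-small-primes {p} {m} {y} {d} covers coprime[y,d] with inverse-mod-primes≤ d p
... | u , inverse with covers (u ℤ.* + y)
... | i , i<m , coprime[x+i,P] = i , i<m , no-small-factor
  where
  u*z-[u*d-1]*i≡u*y+i : ∀ u y d i → u ℤ.* (y ℤ.+ d ℤ.* i) - (u ℤ.* d - 1ℤ) ℤ.* i ≡ u ℤ.* y ℤ.+ i
  u*z-[u*d-1]*i≡u*y+i = solve-∀

  no-small-factor : ∀ {e} → Prime e → e ≤ p → ¬ e ∣ y + d * i
  no-small-factor {e} pe e≤p e∣z with e ∣? d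
  ... | yes e∣d = prime∣coprime⇒∤ pe coprime[y,d] e∣y e∣d
    where
    e∣y : e ∣ y
    e∣y = ∣m+n∣m⇒∣n (subst (e ∣_) (+-comm y (d * i)) e∣z) (∣m⇒∣m*n i e∣d)
  ... | no e∤d = prime∣coprime⇒∤ pe coprime[x+i,P] e∣x+i (prime≤⇒∣primorialUpTo pe e≤p)
    where
    e∣z′ : + e Signed.∣ + y ℤ.+ + d ℤ.* + i
    e∣z′ = subst (+ e Signed.∣_) (pos-+* y d i) (∣ᵤ⇒∣ {+ e} e∣z)
    e∣x+i : e ∣ ∣ u ℤ.* + y ℤ.+ + i ∣
    e∣x+i = ∣⇒∣ᵤ (subst (+ e Signed.∣_) (u*z-[u*d-1]*i≡u*y+i u (+ y) (+ d) (+ i))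
      (Signed.∣m∣n⇒∣m-n (Signed.∣n⇒∣m*n u e∣z′) (Signed.∣m⇒∣m*n (+ i) (inverse pe e≤p e∤d))))

rough-from-primes : ∀ p {z} → (∀ {e} → Prime e → e < p → ¬ e ∣ z) → p Rough z
rough-from-primes zero                _ = 0-rough
rough-from-primes (suc zero)          _ = 1-rough
rough-from-primes (suc (suc zero))    _ = 2-rough
rough-from-primes (suc (suc (suc m))) small =
  let rough = rough-from-primes (suc (suc m)) (λ pe e<2+m → small pe (m<n⇒m<1+n e<2+m))
  in  ∤⇒rough-suc (λ 2+m∣z → small (rough∧∣⇒prime rough 2+m∣z) ≤-refl 2+m∣z) rough

prime-from-no-small-factor : ∀ {p z} → 2 ≤ z → z < p * p → (∀ {e} → Prime e → e < p → ¬ e ∣ z) → Prime z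
prime-from-no-small-factor {p} 2≤z z<p*p small =
  rough∧square>⇒prime {{n>1⇒nonTrivial 2≤z}} (rough-from-primes p small) z<p*p

divMod-from-2 : ∀ (a : ℤ) d .{{_ : NonZero d}} → ∃[ y ] ∃[ q ] (2 ≤ y × y ≤ suc d × a ≡ + y ℤ.+ q ℤ.* + d)
divMod-from-2 a d = 2 + r , q , s≤s (s≤s z≤n) , s≤s (n%ℕd<d (a - + 2) d) , (begin
  a                          ≡⟨ m≡n+[m-n] a (+ 2) ⟩
  + 2 ℤ.+ (a - + 2)          ≡⟨ cong (ℤ._+_ (+ 2)) (a≡a%ℕn+[a/ℕn]*n (a - + 2) d) ⟩
  + 2 ℤ.+ (+ r ℤ.+ q ℤ.* + d) ≡⟨ ℤ-+-assoc (+ 2) (+ r) (q ℤ.* + d) ⟨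
  + 2 ℤ.+ + r ℤ.+ q ℤ.* + d   ≡⟨ cong (ℤ._+ q ℤ.* + d) (pos-+ 2 r) ⟨
  + (2 + r) ℤ.+ q ℤ.* + d     ∎)
  where
  open ≡-Reasoning
  r = (a - + 2) %ℕ d
  q = (a - + 2) /ℕ d
  m≡n+[m-n] : ∀ m n → m ≡ n ℤ.+ (m - n)
  m≡n+[m-n] = solve-∀

gcd≡1⇒coprime-residue : ∀ {a y d} q → gcd a (+ d) ≡ + 1 → a ≡ + y ℤ.+ q ℤ.* + d → Coprime y d
gcd≡1⇒coprime-residue {a} {y} {d} q gcd≡1 a≡y+qd {e} (e∣y , e∣d) = gcd≡1⇒coprime (+-injective gcd≡1) (e∣a , e∣d)
  where
  e∣a : e ∣ ∣ a ∣
  e∣a = ∣⇒∣ᵤ (subst (+ e Signed.∣_) (sym a≡y+qd)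
    (Signed.∣m∣n⇒∣m+n (∣ᵤ⇒∣ {+ e} {+ y} e∣y) (Signed.∣n⇒∣m*n q (∣ᵤ⇒∣ {+ e} {+ d} e∣d))))

residue-bound : ∀ {y d i h} .{{_ : NonZero d}} → y ≤ suc d → i < h → y + d * i ≤ d * (h + 1)
residue-bound {y} {d} {i} {h} y≤1+d i<h = begin
  y + d * i       ≤⟨ +-monoˡ-≤ (d * i) y≤1+d ⟩
  suc (d + d * i) ≡⟨ cong suc (*-suc d i) ⟨
  suc (d * suc i) ≤⟨ s≤s (*-monoʳ-≤ d i<h) ⟩
  1 + d * h       ≤⟨ +-monoˡ-≤ (d * h) (>-nonZero⁻¹ d) ⟩
  d + d * h       ≡⟨ *-suc d h ⟨
  d * suc h       ≡⟨ cong (d *_) (+-comm 1 h) ⟩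
  d * (h + 1)     ∎
  where open ≤-Reasoning

m≤n∸2⇒m<n : ∀ {m} n → 0 < m → m ≤ n ∸ 2 → m < n
m≤n∸2⇒m<n 0             0<m m≤0 = ⊥-elim (<⇒≱ 0<m m≤0)
m≤n∸2⇒m<n 1             0<m m≤0 = ⊥-elim (<⇒≱ 0<m m≤0)
m≤n∸2⇒m<n (suc (suc n)) _   m≤n = m≤n⇒m≤1+n (s≤s m≤n)

theorem2p9 : (d : ℕ) → 1 ≤ d →
    (∃[ k ] ∃[ pk ] ∃[ pk1 ] ∃[ hk ]
      (1 ≤ k × NthPrime k pk × NthPrime (suc k) pk1 × IsJacobsthal (primorialUpTo pk) hk
        × d * (hk + 1) ≤ pk1 ^ 2 ∸ 2)) →
    (a : ℤ) → gcd a (+ d) ≡ + 1 →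
    ∃[ n ] (ℤ.0ℤ ℤ.< a ℤ.+ + d ℤ.* n × Prime ∣ a ℤ.+ + d ℤ.* n ∣)
theorem2p9 zero ()
theorem2p9 d@(suc _) _ (_ , pk , pk1 , _ , _ , pk-nth , pk1-nth , (_ , covers , _) , d[h+1]≤N∸2) a gcd≡1
  with divMod-from-2 a d
... | y , q , 2≤y , y≤1+d , a≡y+qd
  with window-avoiding-small-primes covers (gcd≡1⇒coprime-residue q gcd≡1 a≡y+qd)
... | i , i<h , no-small-factor = + i - q , 0<a+dn , subst Prime (cong ∣_∣ (sym a+dn≡z)) z-prime
  where
  z = y + d * i
  2≤z : 2 ≤ z
  2≤z = ≤-trans 2≤y (m≤m+n y (d * i))
  a+dn≡z : a ℤ.+ + d ℤ.* (+ i - q) ≡ + z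
  a+dn≡z = trans (cong (ℤ._+ + d ℤ.* (+ i - q)) a≡y+qd) (trans (cancel-q (+ y) q (+ d) (+ i)) (sym (pos-+* y d i)))
    where
    cancel-q : ∀ y q d i → y ℤ.+ q ℤ.* d ℤ.+ d ℤ.* (i - q) ≡ y ℤ.+ d ℤ.* i
    cancel-q = solve-∀
  0<a+dn : ℤ.0ℤ ℤ.< a ℤ.+ + d ℤ.* (+ i - q)
  0<a+dn = subst (ℤ.0ℤ ℤ.<_) (sym a+dn≡z) (ℤ.+<+ (≤-trans (s≤s z≤n) 2≤z))
  z<pk1*pk1 : z < pk1 * pk1
  z<pk1*pk1 = subst (z <_) (cong (pk1 *_) (*-identityʳ pk1))
    (m≤n∸2⇒m<n (pk1 ^ 2) (≤-trans (s≤s z≤n) 2≤z) (≤-trans (residue-bound y≤1+d i<h) d[h+1]≤N∸2))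
  z-prime : Prime z
  z-prime = prime-from-no-small-factor 2≤z z<pk1*pk1
    λ pe e<pk1 → no-small-factor pe (nthPrime-gap pk-nth pk1-nth pe e<pk1)
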